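{- Let $M=(E,\rho)$ be a binary non-degenerate $(n,k,d)$-matroid and let $Z^d\in\mathcal{Z}(M)$ be a coatom of $\mathcal{Z}(M)$ with maximal nullity, i.e. $d=\eta(E)+1-\eta(Z^d)$. If $Z^d$ is not blunt, then $d\leq 4$.
   Context: A matroid is binary if representable over $\mathbb{F}_2$; non-degenerate means no loops and no isthmuses. $\eta(X)=|X|-\rho(X)$. An $(n,k,d)$-matroid has $|E|=n$, $\rho(E)=k$ and minimum distance $d=\min\{|X|:X\subseteq E,\ \rho(E-X)<\rho(E)\}$; for non-degenerate $M$ one has $d=\eta(E)+1-\max\{\eta(Z):Z\in\mathcal{Z}(M)-\{E\}\}$. $\mathcal{Z}(M)$ is the lattice under inclusion of cyclic flats (sets $X$ with $\mathrm{cl}(X)=X$ and $\mathrm{cyc}(X)=X$, where $\mathrm{cl}(X)=\{e:\rho(X\cup e)=\rho(X)\}$, $\mathrm{cyc}(X)=\{e\in X:\rho(X-e)=\rho(X)\}$); a coatom is an element covered by the top element. A cyclic flat $Z$ of a binary matroid is blunt if every $Z'\in\mathcal{Z}(M)$ covered by $Z$ in $\mathcal{Z}(M)$ satisfies $\rho(Z')=\rho(Z)-1$. -}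

module Defs where

open import Data.Nat using (ℕ; zero; suc; _+_; _∸_; _≤_; _<_)
open import Data.Nat.Properties using (_≟_)
open import Data.Bool using (Bool; true; false; _xor_; if_then_else_)
open import Data.Fin using (Fin)
open import Data.Fin.Subset
  using (Subset; inside; outside; _∈_; _∉_; _⊆_; _⊂_; _∪_; _∩_; _─_; _-_; ⁅_⁆; ⊤; ∣_∣; Nonempty)
open import Data.Vec using (Vec; replicate; zipWith; tabulate; lookup)
open import Data.Product using (Σ; ∃; _×_)
open import Relation.Nullary using (¬_)
open import Relation.Nullary.Decidable using (⌊_⌋)
open import Relation.Binary.PropositionalEquality using (_≡_; _≢_)

RankFn : ℕ → Set
RankFn n = Subset n → ℕ

record IsMatroid {n : ℕ} (ρ : RankFn n) : Set where
  field
    bounded    : ∀ X → ρ X ≤ ∣ X ∣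
    monotone   : ∀ X Y → X ⊆ Y → ρ X ≤ ρ Y
    submodular : ∀ X Y → ρ (X ∪ Y) + ρ (X ∩ Y) ≤ ρ X + ρ Y

-- Binary representability: columns A e ∈ 𝔽₂^m (𝔽₂ = Bool with xor).

zeroVec : (m : ℕ) → Vec Bool m
zeroVec m = replicate m false

sumCols : ∀ {n m} → (Fin n → Vec Bool m) → Subset n → Vec Bool m
sumCols {zero}  {m} A S = zeroVec m
sumCols {suc n} {m} A (inside  Data.Vec.∷ S) = zipWith _xor_ (A Fin.zero) (sumCols (λ i → A (Fin.suc i)) S)
  where import Data.Fin as Fin
sumCols {suc n} {m} A (outside Data.Vec.∷ S) = sumCols (λ i → A (Fin.suc i)) S
  where import Data.Fin as Fin

-- linear independence over 𝔽₂ of the columns indexed by S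
-- (no nontrivial 𝔽₂-linear combination, i.e. no nonempty subfamily, sums to 0)
LinIndep : ∀ {n m} → (Fin n → Vec Bool m) → Subset n → Set
LinIndep A S = ∀ T → T ⊆ S → Nonempty T → sumCols A T ≢ zeroVec _

IsRankOf : ∀ {n m} → (Fin n → Vec Bool m) → Subset n → ℕ → Set
IsRankOf A X r =
  (∃ λ Y → Y ⊆ X × LinIndep A Y × ∣ Y ∣ ≡ r) ×
  (∀ Y → Y ⊆ X → LinIndep A Y → ∣ Y ∣ ≤ r)

Binary : ∀ {n} → RankFn n → Set
Binary {n} ρ = Σ ℕ λ m → Σ (Fin n → Vec Bool m) λ A → ∀ X → IsRankOf A X (ρ X)

η : ∀ {n} → RankFn n → Subset n → ℕ
η ρ X = ∣ X ∣ ∸ ρ X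

NoLoops : ∀ {n} → RankFn n → Set
NoLoops ρ = ∀ e → ρ ⁅ e ⁆ ≡ 1

NoIsthmuses : ∀ {n} → RankFn n → Set
NoIsthmuses ρ = ∀ e → ρ (⊤ - e) ≡ ρ ⊤

NonDegenerate : ∀ {n} → RankFn n → Set
NonDegenerate ρ = NoLoops ρ × NoIsthmuses ρ

IsMinDistance : ∀ {n} → RankFn n → ℕ → Set
IsMinDistance ρ d =
  (∃ λ X → ρ (⊤ ─ X) < ρ ⊤ × ∣ X ∣ ≡ d) ×
  (∀ X → ρ (⊤ ─ X) < ρ ⊤ → d ≤ ∣ X ∣)

cl : ∀ {n} → RankFn n → Subset n → Subset n
cl ρ X = tabulate λ e → if ⌊ ρ (X ∪ ⁅ e ⁆) ≟ ρ X ⌋ then inside else outside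

cyc : ∀ {n} → RankFn n → Subset n → Subset n
cyc ρ X = tabulate λ e →
  if lookup X e then (if ⌊ ρ (X - e) ≟ ρ X ⌋ then inside else outside) else outside

IsCyclicFlat : ∀ {n} → RankFn n → Subset n → Set
IsCyclicFlat ρ X = cl ρ X ≡ X × cyc ρ X ≡ X

CoveredBy : ∀ {n} → RankFn n → Subset n → Subset n → Set
CoveredBy ρ Z' Z =
  IsCyclicFlat ρ Z' × IsCyclicFlat ρ Z × Z' ⊂ Z ×
  (∀ W → IsCyclicFlat ρ W → Z' ⊂ W → ¬ (W ⊂ Z))

IsTopCyclicFlat : ∀ {n} → RankFn n → Subset n → Set
IsTopCyclicFlat ρ T = IsCyclicFlat ρ T × (∀ W → IsCyclicFlat ρ W → W ⊆ T)

IsCoatom : ∀ {n} → RankFn n → Subset n → Set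
IsCoatom ρ Z = ∃ λ T → IsTopCyclicFlat ρ T × CoveredBy ρ Z T

Blunt : ∀ {n} → RankFn n → Subset n → Set
Blunt ρ Z = ∀ Z' → CoveredBy ρ Z' Z → ρ Z' + 1 ≡ ρ Z

module Submission where

-- Non-bluntness gives Z′ ⋖ Z = Z^d in the lattice of cyclic flats with ρ Z′ + 2 ≤ ρ Z; extend Z′
-- inside Z to a set S of rank ρ Z − 2. Covering prevents any e ∈ Z − X from lying in cl X when
-- Z′ ⊆ X ⊆ Z and ρ X < ρ Z: a cycle through e would make cl (Z′ ∪ cycle) a cyclic flat strictly
-- between Z′ and Z. So the elements of Z − S are pairwise independent in M / S, and since the
-- binary matroid M / S has no U₂,₄ minor, for any two of them x, y all the others are parallel in
-- M / S. Hence ρ (Z − x − y) ≤ ρ S + 1 < ρ Z, so X = Z − x − y has corank ≥ 2 and η X ≥ η Z − 1.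
-- Extend X, keeping its nullity, to a set S₁ of corank 2. The three hyperplanes through cl S₁
-- have complements of size ≥ d and every element outside cl S₁ misses at most two of them, so
-- 3d ≤ 2 ∣E − cl S₁∣ ≤ 2 (η E − η X + 2) ≤ 2 (d + 2).

open import Defs
open import Data.Nat using (ℕ; zero; suc; _+_; _*_; _∸_; _≤_; _<_; z≤n; s≤s)
open import Data.Nat.Properties
open import Data.Bool using (Bool; true; false; _xor_; if_then_else_)
open import Data.Bool.Properties as Bool using (xor-assoc; xor-comm; xor-identityʳ; xor-same)
open import Data.Fin using (Fin; zero; suc)
open import Data.Fin.Properties using (any?) renaming (_≟_ to _≟ᶠ_)
open import Data.Fin.Subset
open import Data.Fin.Subset.Properties
open import Data.Vec using (Vec; []; _∷_; zipWith; tabulate; lookup; here; there)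
open import Data.Vec.Properties
  using (≡-dec; zipWith-assoc; zipWith-comm; zipWith-identityʳ; lookup∘tabulate; []=⇒lookup; lookup⇒[]=)
open import Data.Product using (∃; ∃₂; _×_; _,_; proj₁; proj₂)
open import Data.Sum using (_⊎_; inj₁; inj₂; [_,_])
open import Function using (_∘_)
open import Relation.Nullary using (¬_; Dec; yes; no)
open import Relation.Nullary.Decidable using (⌊_⌋; _×-dec_; ¬?)
open import Relation.Nullary.Negation using (contradiction)
open import Relation.Binary.PropositionalEquality
  using (_≡_; _≢_; refl; sym; trans; cong; cong₂; subst; module ≡-Reasoning)
open import Data.Nat.Tactic.RingSolver using (solve-∀)

private
  variable
    n m : ℕ
    p q r s : Subset n
    x y : Fin n

-- Subsets

x∈p─q⇒x∉q : x ∈ p ─ q → x ∉ q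
x∈p─q⇒x∉q {x = zero}  {p = _ ∷ _} {q = outside ∷ _} _          ()
x∈p─q⇒x∉q {x = zero}  {p = _ ∷ _} {q = inside  ∷ _} ()
x∈p─q⇒x∉q {x = suc _} {p = _ ∷ _} {q = _       ∷ _} (there x∈) (there x∈q) = x∈p─q⇒x∉q x∈ x∈q

x∈p-y⇒x≢y : x ∈ p - y → x ≢ y
x∈p-y⇒x≢y x∈ refl = x∈p─q⇒x∉q x∈ (x∈⁅x⁆ _)

x∉p-x : x ∉ p - x
x∉p-x x∈p-x = x∈p-y⇒x≢y x∈p-x refl

x∈p-y-z⁻ : ∀ {z} → x ∈ p - y - z → x ∈ p × x ≢ y × x ≢ z
x∈p-y-z⁻ {p = p} {y = y} x∈ =
  p─q⊆p p _ (p─q⊆p (p - y) _ x∈) , x∈p-y⇒x≢y (p─q⊆p (p - y) _ x∈) , x∈p-y⇒x≢y x∈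

∪-⊆ : p ⊆ r → q ⊆ r → p ∪ q ⊆ r
∪-⊆ {p = p} p⊆r q⊆r = [ p⊆r , q⊆r ] ∘ x∈p∪q⁻ p _

∪-monoˡ-⊆ : p ⊆ q → p ∪ r ⊆ q ∪ r
∪-monoˡ-⊆ {q = q} {r = r} p⊆q = ∪-⊆ (⊆-trans p⊆q (p⊆p∪q r)) (q⊆p∪q q r)

x∈p⇒⁅x⁆⊆p : x ∈ p → ⁅ x ⁆ ⊆ p
x∈p⇒⁅x⁆⊆p x∈p y∈⁅x⁆ rewrite x∈⁅y⁆⇒x≡y _ y∈⁅x⁆ = x∈p

∪⁅⁆⊆ : p ⊆ q → x ∈ q → p ∪ ⁅ x ⁆ ⊆ q
∪⁅⁆⊆ p⊆q x∈q = ∪-⊆ p⊆q (x∈p⇒⁅x⁆⊆p x∈q)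

x∈p∪⁅x⁆ : ∀ (p : Subset n) x → x ∈ p ∪ ⁅ x ⁆
x∈p∪⁅x⁆ p x = q⊆p∪q p _ (x∈⁅x⁆ x)

∉∪ : x ∉ p → x ∉ q → x ∉ p ∪ q
∉∪ {p = p} x∉p x∉q = [ x∉p , x∉q ] ∘ x∈p∪q⁻ p _

∉∪⁅⁆ : x ∉ p → x ≢ y → x ∉ p ∪ ⁅ y ⁆
∉∪⁅⁆ x∉p x≢y = ∉∪ x∉p (x≢y ∘ x∈⁅y⁆⇒x≡y _)

x∈p⇒p-x∪⁅x⁆≡p : x ∈ p → (p - x) ∪ ⁅ x ⁆ ≡ p
x∈p⇒p-x∪⁅x⁆≡p {x = x} {p = p} x∈p = ⊆-antisym (∪⁅⁆⊆ (p─q⊆p p _) x∈p) p⊆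
  where
  p⊆ : p ⊆ (p - x) ∪ ⁅ x ⁆
  p⊆ {z} z∈p with z ≟ᶠ x
  ... | yes refl = x∈p∪⁅x⁆ (p - x) z
  ... | no z≢x   = p⊆p∪q _ (x∈p∧x≢y⇒x∈p-y z∈p z≢x)

p⊆q⇒p-x⊆q-x : p ⊆ q → p - x ⊆ q - x
p⊆q⇒p-x⊆q-x {p = p} p⊆q y∈ = x∈p∧x≢y⇒x∈p-y (p⊆q (p─q⊆p p _ y∈)) (x∈p-y⇒x≢y y∈)

p⊆q∪⁅x⁆⇒p-x⊆q : p ⊆ q ∪ ⁅ x ⁆ → p - x ⊆ q
p⊆q∪⁅x⁆⇒p-x⊆q {p = p} {q = q} p⊆ y∈ with x∈p∪q⁻ q _ (p⊆ (p─q⊆p p _ y∈))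
... | inj₁ y∈q   = y∈q
... | inj₂ y∈⁅x⁆ = contradiction (x∈⁅y⁆⇒x≡y _ y∈⁅x⁆) (x∈p-y⇒x≢y y∈)

p⊆q∪⁅x⁆∧x∉p⇒p⊆q : p ⊆ q ∪ ⁅ x ⁆ → x ∉ p → p ⊆ q
p⊆q∪⁅x⁆∧x∉p⇒p⊆q p⊆ x∉p y∈p =
  p⊆q∪⁅x⁆⇒p-x⊆q p⊆ (x∈p∧x≢y⇒x∈p-y y∈p (λ { refl → x∉p y∈p }))

q⊆r⇒p─r⊆p─q : q ⊆ r → p ─ r ⊆ p ─ q
q⊆r⇒p─r⊆p─q {p = p} q⊆r x∈ = x∈p∧x∉q⇒x∈p─q (p─q⊆p p _ x∈) (x∈p─q⇒x∉q x∈ ∘ q⊆r)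

p─[p─q]⊆q : ∀ (p q : Subset n) → p ─ (p ─ q) ⊆ q
p─[p─q]⊆q p q {x} x∈ with x ∈? q
... | yes x∈q = x∈q
... | no  x∉q = contradiction (x∈p∧x∉q⇒x∈p─q (p─q⊆p p _ x∈) x∉q) (x∈p─q⇒x∉q x∈)

⊆∧⊄⇒⊇ : p ⊆ q → ¬ (p ⊂ q) → q ⊆ p
⊆∧⊄⇒⊇ {p = p} p⊆q p⊄q {x} x∈q with x ∈? p
... | yes x∈p = x∈p
... | no  x∉p = contradiction ((λ {y} → p⊆q {y}) , x , x∈q , x∉p) p⊄q

∣p∪⁅x⁆∣≡1+∣p∣ : x ∉ p → ∣ p ∪ ⁅ x ⁆ ∣ ≡ suc ∣ p ∣
∣p∪⁅x⁆∣≡1+∣p∣ {x = zero}  {p = outside ∷ p} _   = cong suc (cong ∣_∣ (∪-identityʳ p))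
∣p∪⁅x⁆∣≡1+∣p∣ {x = zero}  {p = inside  ∷ p} x∉p = contradiction here x∉p
∣p∪⁅x⁆∣≡1+∣p∣ {x = suc x} {p = outside ∷ p} x∉p = ∣p∪⁅x⁆∣≡1+∣p∣ (x∉p ∘ there)
∣p∪⁅x⁆∣≡1+∣p∣ {x = suc x} {p = inside  ∷ p} x∉p = cong suc (∣p∪⁅x⁆∣≡1+∣p∣ (x∉p ∘ there))

∣p-x∣+1≡∣p∣ : x ∈ p → suc ∣ p - x ∣ ≡ ∣ p ∣
∣p-x∣+1≡∣p∣ {x = x} {p = p} x∈p = begin
  suc ∣ p - x ∣       ≡⟨ ∣p∪⁅x⁆∣≡1+∣p∣ {p = p - x} x∉p-x ⟨
  ∣ (p - x) ∪ ⁅ x ⁆ ∣ ≡⟨ cong ∣_∣ (x∈p⇒p-x∪⁅x⁆≡p x∈p) ⟩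
  ∣ p ∣               ∎
  where open ≡-Reasoning

∣p∪q∣+∣p∩q∣≡∣p∣+∣q∣ : ∀ (p q : Subset n) → ∣ p ∪ q ∣ + ∣ p ∩ q ∣ ≡ ∣ p ∣ + ∣ q ∣
∣p∪q∣+∣p∩q∣≡∣p∣+∣q∣ []            []            = refl
∣p∪q∣+∣p∩q∣≡∣p∣+∣q∣ (outside ∷ p) (outside ∷ q) = ∣p∪q∣+∣p∩q∣≡∣p∣+∣q∣ p q
∣p∪q∣+∣p∩q∣≡∣p∣+∣q∣ (inside  ∷ p) (outside ∷ q) = cong suc (∣p∪q∣+∣p∩q∣≡∣p∣+∣q∣ p q)
∣p∪q∣+∣p∩q∣≡∣p∣+∣q∣ (outside ∷ p) (inside  ∷ q) = begin
  suc ∣ p ∪ q ∣ + ∣ p ∩ q ∣ ≡⟨ cong suc (∣p∪q∣+∣p∩q∣≡∣p∣+∣q∣ p q) ⟩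
  suc (∣ p ∣ + ∣ q ∣)       ≡⟨ +-suc ∣ p ∣ ∣ q ∣ ⟨
  ∣ p ∣ + suc ∣ q ∣         ∎
  where open ≡-Reasoning
∣p∪q∣+∣p∩q∣≡∣p∣+∣q∣ (inside  ∷ p) (inside  ∷ q) = begin
  suc ∣ p ∪ q ∣ + suc ∣ p ∩ q ∣ ≡⟨ cong suc (+-suc ∣ p ∪ q ∣ ∣ p ∩ q ∣) ⟩
  suc (suc (∣ p ∪ q ∣ + ∣ p ∩ q ∣)) ≡⟨ cong (λ k → suc (suc k)) (∣p∪q∣+∣p∩q∣≡∣p∣+∣q∣ p q) ⟩
  suc (suc (∣ p ∣ + ∣ q ∣))     ≡⟨ cong suc (+-suc ∣ p ∣ ∣ q ∣) ⟨
  suc ∣ p ∣ + suc ∣ q ∣         ∎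
  where open ≡-Reasoning

p∪q⊆r∧p∩q⊆s⇒∣p∣+∣q∣≤∣r∣+∣s∣ : p ∪ q ⊆ r → p ∩ q ⊆ s → ∣ p ∣ + ∣ q ∣ ≤ ∣ r ∣ + ∣ s ∣
p∪q⊆r∧p∩q⊆s⇒∣p∣+∣q∣≤∣r∣+∣s∣ {p = p} {q} p∪q⊆r p∩q⊆s = begin
  ∣ p ∣ + ∣ q ∣         ≡⟨ ∣p∪q∣+∣p∩q∣≡∣p∣+∣q∣ p q ⟨
  ∣ p ∪ q ∣ + ∣ p ∩ q ∣ ≤⟨ +-mono-≤ (p⊆q⇒∣p∣≤∣q∣ p∪q⊆r) (p⊆q⇒∣p∣≤∣q∣ p∩q⊆s) ⟩
  _                     ∎
  where open ≤-Reasoning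

∪⁅⁆-induction : (P : Subset n → Set) → P ⊥ →
  (∀ {p x} → p ⊆ q → x ∈ q → P p → P (p ∪ ⁅ x ⁆)) → P q
∪⁅⁆-induction {q = q} P P⊥ step = go ∣ q ∣ ≤-refl ⊆-refl
  where
  go : ∀ k {p} → ∣ p ∣ ≤ k → p ⊆ q → P p
  go k {p} ∣p∣≤k p⊆q with nonempty? p
  ... | no ∅ = subst P (sym (Empty-unique ∅)) P⊥
  go (suc k) {p} ∣p∣≤k p⊆q | yes (x , x∈p) =
    subst P (x∈p⇒p-x∪⁅x⁆≡p x∈p)
      (step p-x⊆q (p⊆q x∈p) (go k (≤-pred (≤-trans (x∈p⇒∣p-x∣<∣p∣ x∈p) ∣p∣≤k)) p-x⊆q))
    where
    p-x⊆q : p - x ⊆ q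
    p-x⊆q = ⊆-trans (p─q⊆p p _) p⊆q
  go zero {p} ∣p∣≤k p⊆q | yes (x , x∈p) = contradiction (≤-trans (x∈p⇒∣p-x∣<∣p∣ x∈p) ∣p∣≤k) λ ()

∈tabulate⁻ : ∀ {f : Fin n → Bool} → x ∈ tabulate f → f x ≡ true
∈tabulate⁻ {x = x} x∈ = trans (sym (lookup∘tabulate _ x)) ([]=⇒lookup x∈)

∈tabulate⁺ : ∀ {f : Fin n → Bool} → f x ≡ true → x ∈ tabulate f
∈tabulate⁺ {x = x} fx≡true = lookup⇒[]= x _ (trans (lookup∘tabulate _ x) fx≡true)

if-⌊⌋⁻ : ∀ {A : Set} (a? : Dec A) → (if ⌊ a? ⌋ then true else false) ≡ true → A
if-⌊⌋⁻ (yes a) _ = a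

if-⌊⌋⁺ : ∀ {A : Set} (a? : Dec A) → A → (if ⌊ a? ⌋ then true else false) ≡ true
if-⌊⌋⁺ (yes _) _ = refl
if-⌊⌋⁺ (no ¬a) a = contradiction a ¬a

-- Vectors over 𝔽₂ and column sums

infixl 6 _⊕_ _△_

_⊕_ : Vec Bool m → Vec Bool m → Vec Bool m
_⊕_ = zipWith _xor_

_△_ : Subset n → Subset n → Subset n
_△_ = zipWith _xor_

⊕-assoc : ∀ (u v w : Vec Bool m) → u ⊕ v ⊕ w ≡ u ⊕ (v ⊕ w)
⊕-assoc = zipWith-assoc xor-assoc

⊕-comm : ∀ (u v : Vec Bool m) → u ⊕ v ≡ v ⊕ u
⊕-comm = zipWith-comm xor-comm

⊕-identityʳ : ∀ (u : Vec Bool m) → u ⊕ zeroVec m ≡ u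
⊕-identityʳ = zipWith-identityʳ xor-identityʳ

⊕-self : ∀ (u : Vec Bool m) → u ⊕ u ≡ zeroVec m
⊕-self []      = refl
⊕-self (b ∷ u) = cong₂ _∷_ (xor-same b) (⊕-self u)

⊕-cancelʳ : ∀ (u v : Vec Bool m) → u ⊕ v ⊕ v ≡ u
⊕-cancelʳ u v = begin
  u ⊕ v ⊕ v       ≡⟨ ⊕-assoc u v v ⟩
  u ⊕ (v ⊕ v)     ≡⟨ cong (u ⊕_) (⊕-self v) ⟩
  u ⊕ zeroVec _   ≡⟨ ⊕-identityʳ u ⟩
  u               ∎
  where open ≡-Reasoning

⊕≡0⇒≡ : ∀ {u v : Vec Bool m} → u ⊕ v ≡ zeroVec m → u ≡ v
⊕≡0⇒≡ {u = u} {v = v} u⊕v≡0 = begin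
  u               ≡⟨ ⊕-cancelʳ u v ⟨
  u ⊕ v ⊕ v       ≡⟨ cong (_⊕ v) u⊕v≡0 ⟩
  zeroVec _ ⊕ v   ≡⟨ ⊕-comm _ v ⟩
  v ⊕ zeroVec _   ≡⟨ ⊕-identityʳ v ⟩
  v               ∎
  where open ≡-Reasoning

⊕-left-comm : ∀ (u v w : Vec Bool m) → u ⊕ (v ⊕ w) ≡ v ⊕ (u ⊕ w)
⊕-left-comm u v w = begin
  u ⊕ (v ⊕ w)     ≡⟨ ⊕-assoc u v w ⟨
  u ⊕ v ⊕ w       ≡⟨ cong (_⊕ w) (⊕-comm u v) ⟩
  v ⊕ u ⊕ w       ≡⟨ ⊕-assoc v u w ⟩
  v ⊕ (u ⊕ w)     ∎
  where open ≡-Reasoning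

⊕-cancelˡ-common : ∀ (w u v : Vec Bool m) → (w ⊕ u) ⊕ (w ⊕ v) ≡ u ⊕ v
⊕-cancelˡ-common w u v = begin
  (w ⊕ u) ⊕ (w ⊕ v) ≡⟨ cong (_⊕ (w ⊕ v)) (⊕-comm w u) ⟩
  (u ⊕ w) ⊕ (w ⊕ v) ≡⟨ ⊕-assoc u w (w ⊕ v) ⟩
  u ⊕ (w ⊕ (w ⊕ v)) ≡⟨ cong (u ⊕_) (⊕-assoc w w v) ⟨
  u ⊕ (w ⊕ w ⊕ v)   ≡⟨ cong (λ z → u ⊕ (z ⊕ v)) (⊕-self w) ⟩
  u ⊕ (zeroVec _ ⊕ v) ≡⟨ cong (u ⊕_) (trans (⊕-comm _ v) (⊕-identityʳ v)) ⟩
  u ⊕ v             ∎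
  where open ≡-Reasoning

p△q⊆p∪q : ∀ (p q : Subset n) → p △ q ⊆ p ∪ q
p△q⊆p∪q (inside  ∷ p) (outside ∷ q) here        = here
p△q⊆p∪q (outside ∷ p) (inside  ∷ q) here        = here
p△q⊆p∪q (_       ∷ p) (_       ∷ q) (there x∈) = there (p△q⊆p∪q p q x∈)

sumCols-⊥ : ∀ (A : Fin n → Vec Bool m) → sumCols A ⊥ ≡ zeroVec m
sumCols-⊥ {zero}  A = refl
sumCols-⊥ {suc n} A = sumCols-⊥ (A ∘ suc)

sumCols-∪⁅⁆ : ∀ (A : Fin n → Vec Bool m) {U x} → x ∉ U →
              sumCols A (U ∪ ⁅ x ⁆) ≡ sumCols A U ⊕ A x
sumCols-∪⁅⁆ A {outside ∷ U} {zero}  _   =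
  trans (cong (λ V → A zero ⊕ sumCols (A ∘ suc) V) (∪-identityʳ U)) (⊕-comm (A zero) _)
sumCols-∪⁅⁆ A {inside  ∷ U} {zero}  x∉U = contradiction here x∉U
sumCols-∪⁅⁆ A {outside ∷ U} {suc x} x∉U = sumCols-∪⁅⁆ (A ∘ suc) (x∉U ∘ there)
sumCols-∪⁅⁆ A {inside  ∷ U} {suc x} x∉U =
  trans (cong (A zero ⊕_) (sumCols-∪⁅⁆ (A ∘ suc) (x∉U ∘ there))) (sym (⊕-assoc (A zero) _ _))

sumCols-△ : ∀ (A : Fin n → Vec Bool m) U V → sumCols A (U △ V) ≡ sumCols A U ⊕ sumCols A V
sumCols-△ A []            []            = sym (⊕-self _)
sumCols-△ A (outside ∷ U) (outside ∷ V) = sumCols-△ (A ∘ suc) U V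
sumCols-△ A (inside  ∷ U) (outside ∷ V) =
  trans (cong (A zero ⊕_) (sumCols-△ (A ∘ suc) U V)) (sym (⊕-assoc (A zero) _ _))
sumCols-△ A (outside ∷ U) (inside  ∷ V) =
  trans (cong (A zero ⊕_) (sumCols-△ (A ∘ suc) U V)) (⊕-left-comm (A zero) _ _)
sumCols-△ A (inside  ∷ U) (inside  ∷ V) =
  trans (sumCols-△ (A ∘ suc) U V) (sym (⊕-cancelˡ-common (A zero) _ _))

sumCols-closed : ∀ (P : Vec Bool m → Set) → P (zeroVec m) → (∀ {u v} → P u → P v → P (u ⊕ v)) →
                 ∀ (A : Fin n → Vec Bool m) {U} → (∀ {x} → x ∈ U → P (A x)) → P (sumCols A U)
sumCols-closed P P0 P⊕ A {[]}          _     = P0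
sumCols-closed P P0 P⊕ A {outside ∷ U} PU    = sumCols-closed P P0 P⊕ (A ∘ suc) (PU ∘ there)
sumCols-closed P P0 P⊕ A {inside  ∷ U} PU    =
  P⊕ (PU here) (sumCols-closed P P0 P⊕ (A ∘ suc) (PU ∘ there))

-- Arithmetic

3d≤2D : ∀ {d a b c r D} → d ≤ a → d ≤ b → d ≤ c → a + b ≤ D + r → c + r ≤ D → 3 * d ≤ 2 * D
3d≤2D {d} {a} {b} {c} {r} {D} d≤a d≤b d≤c a+b≤D+r c+r≤D = +-cancelʳ-≤ r _ _ (begin
  3 * d + r             ≡⟨ triple d r ⟩
  d + d + d + r         ≤⟨ +-monoˡ-≤ r (+-mono-≤ (+-mono-≤ d≤a d≤b) d≤c) ⟩
  a + b + c + r         ≡⟨ +-assoc (a + b) c r ⟩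
  (a + b) + (c + r)     ≤⟨ +-mono-≤ a+b≤D+r c+r≤D ⟩
  (D + r) + D           ≡⟨ double D r ⟩
  2 * D + r             ∎)
  where
  open ≤-Reasoning
  triple : ∀ d r → 3 * d + r ≡ d + d + d + r
  triple = solve-∀
  double : ∀ D r → (D + r) + D ≡ 2 * D + r
  double = solve-∀

-- When a > c + 1, truncated subtraction makes d = 0.
d≤4-arithmetic : ∀ {d a b c} → 3 * d + 2 * b ≤ 2 * (2 + c) → a ≤ suc b → d ≡ c + 1 ∸ a → d ≤ 4
d≤4-arithmetic {d} {a} {b} {c} bound a≤1+b d≡ with a ≤? c + 1
... | no  a≰c+1 = ≤-trans (≤-reflexive (trans d≡ (m≤n⇒m∸n≡0 (<⇒≤ (≰⇒> a≰c+1))))) z≤n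
... | yes a≤c+1 = +-cancelʳ-≤ (2 * d) _ _ (+-cancelʳ-≤ (2 * a) _ _ (begin
  d + 2 * d + 2 * a         ≡⟨ split d a ⟩
  3 * d + 2 * a             ≤⟨ +-monoʳ-≤ (3 * d) (*-monoʳ-≤ 2 a≤1+b) ⟩
  3 * d + 2 * suc b         ≡⟨ shift d b ⟩
  3 * d + 2 * b + 2         ≤⟨ +-monoˡ-≤ 2 bound ⟩
  2 * (2 + c) + 2           ≡⟨ regroup c ⟩
  4 + 2 * (c + 1)           ≡⟨ cong (λ t → 4 + 2 * t) d+a≡c+1 ⟨
  4 + 2 * (d + a)           ≡⟨ cong (4 +_) (*-distribˡ-+ 2 d a) ⟩
  4 + (2 * d + 2 * a)       ≡⟨ +-assoc 4 (2 * d) (2 * a) ⟨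
  4 + 2 * d + 2 * a         ∎))
  where
  open ≤-Reasoning
  d+a≡c+1 : d + a ≡ c + 1
  d+a≡c+1 = trans (cong (_+ a) d≡) (m∸n+n≡m a≤c+1)
  split : ∀ d a → d + 2 * d + 2 * a ≡ 3 * d + 2 * a
  split = solve-∀
  shift : ∀ d b → 3 * d + 2 * suc b ≡ 3 * d + 2 * b + 2
  shift = solve-∀
  regroup : ∀ c → 2 * (2 + c) + 2 ≡ 4 + 2 * (c + 1)
  regroup = solve-∀

module Matroid {n : ℕ} {ρ : RankFn n} (M : IsMatroid ρ) where
  open IsMatroid M

  private
    variable
      C D F S U X Y : Subset n

  ρ-mono : X ⊆ Y → ρ X ≤ ρ Y
  ρ-mono = monotone _ _

  η+ρ≡∣∣ : ∀ X → η ρ X + ρ X ≡ ∣ X ∣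
  η+ρ≡∣∣ X = m∸n+n≡m (bounded X)

  ρ-∪⁅⁆-≤ : ∀ X x → ρ (X ∪ ⁅ x ⁆) ≤ suc (ρ X)
  ρ-∪⁅⁆-≤ X x = begin
    ρ (X ∪ ⁅ x ⁆)                     ≤⟨ m≤m+n _ _ ⟩
    ρ (X ∪ ⁅ x ⁆) + ρ (X ∩ ⁅ x ⁆)     ≤⟨ submodular X ⁅ x ⁆ ⟩
    ρ X + ρ ⁅ x ⁆                     ≤⟨ +-monoʳ-≤ (ρ X) (subst (ρ ⁅ x ⁆ ≤_) (∣⁅x⁆∣≡1 x)
                                                                  (bounded ⁅ x ⁆)) ⟩
    ρ X + 1                           ≡⟨ +-comm (ρ X) 1 ⟩
    suc (ρ X)                         ∎
    where open ≤-Reasoning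

  ρ-diminishing : ∀ x → X ⊆ Y → ρ (Y ∪ ⁅ x ⁆) + ρ X ≤ ρ Y + ρ (X ∪ ⁅ x ⁆)
  ρ-diminishing {X} {Y} x X⊆Y = begin
    ρ (Y ∪ ⁅ x ⁆) + ρ X                               ≤⟨ +-mono-≤ (ρ-mono Y∪x⊆) (ρ-mono X⊆) ⟩
    ρ (Y ∪ (X ∪ ⁅ x ⁆)) + ρ (Y ∩ (X ∪ ⁅ x ⁆))         ≤⟨ submodular Y (X ∪ ⁅ x ⁆) ⟩
    ρ Y + ρ (X ∪ ⁅ x ⁆)                               ∎
    where
    open ≤-Reasoning
    Y∪x⊆ : Y ∪ ⁅ x ⁆ ⊆ Y ∪ (X ∪ ⁅ x ⁆)
    Y∪x⊆ = ∪-⊆ (p⊆p∪q _) (⊆-trans (q⊆p∪q X _) (q⊆p∪q Y _))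
    X⊆ : X ⊆ Y ∩ (X ∪ ⁅ x ⁆)
    X⊆ z∈X = x∈p∩q⁺ (X⊆Y z∈X , p⊆p∪q _ z∈X)

  ρ-∪-absorb : (∀ {y} → y ∈ Y → ρ (X ∪ ⁅ y ⁆) ≤ ρ X) → ρ (X ∪ Y) ≤ ρ X
  ρ-∪-absorb {Y} {X} absorbs = ∪⁅⁆-induction (λ p → ρ (X ∪ p) ≤ ρ X)
    (≤-reflexive (cong ρ (∪-identityʳ X))) step
    where
    step : ∀ {p y} → p ⊆ Y → y ∈ Y → ρ (X ∪ p) ≤ ρ X → ρ (X ∪ (p ∪ ⁅ y ⁆)) ≤ ρ X
    step {p} {y} _ y∈Y ρX∪p≤ = +-cancelʳ-≤ (ρ X) _ _ (begin
      ρ (X ∪ (p ∪ ⁅ y ⁆)) + ρ X   ≡⟨ cong (λ Z → ρ Z + ρ X) (∪-assoc X p ⁅ y ⁆) ⟨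
      ρ ((X ∪ p) ∪ ⁅ y ⁆) + ρ X   ≤⟨ ρ-diminishing y (p⊆p∪q p) ⟩
      ρ (X ∪ p) + ρ (X ∪ ⁅ y ⁆)   ≤⟨ +-mono-≤ ρX∪p≤ (absorbs y∈Y) ⟩
      ρ X + ρ X                   ∎)
      where open ≤-Reasoning

  ∈cl⁺ : ∀ {x} → ρ (X ∪ ⁅ x ⁆) ≤ ρ X → x ∈ cl ρ X
  ∈cl⁺ {X} {x} ρX∪x≤ρX =
    ∈tabulate⁺ (if-⌊⌋⁺ (ρ (X ∪ ⁅ x ⁆) ≟ ρ X) (≤-antisym ρX∪x≤ρX (ρ-mono (p⊆p∪q _))))

  ∈cl⁻ : ∀ {x} → x ∈ cl ρ X → ρ (X ∪ ⁅ x ⁆) ≡ ρ X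
  ∈cl⁻ {X} {x} x∈ = if-⌊⌋⁻ (ρ (X ∪ ⁅ x ⁆) ≟ ρ X) (∈tabulate⁻ x∈)

  ∉cl⇒ρ< : ∀ {x} → x ∉ cl ρ X → ρ X < ρ (X ∪ ⁅ x ⁆)
  ∉cl⇒ρ< {X} {x} x∉ = ≮⇒≥ (x∉ ∘ ∈cl⁺ ∘ ≤-pred) 

  ∈cyc⁻ : ∀ {x} → x ∈ cyc ρ X → ρ (X - x) ≡ ρ X
  ∈cyc⁻ {X} {x} x∈ with lookup X x | ∈tabulate⁻ x∈
  ... | true | eq = if-⌊⌋⁻ (ρ (X - x) ≟ ρ X) eq

  ∈cyc⁺ : ∀ {x} → x ∈ X → ρ (X - x) ≡ ρ X → x ∈ cyc ρ X
  ∈cyc⁺ {X} {x} x∈X ρX-x≡ρX = ∈tabulate⁺ x∈cyc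
    where
    x∈cyc : (if lookup X x then (if ⌊ ρ (X - x) ≟ ρ X ⌋ then true else false) else false) ≡ true
    x∈cyc rewrite []=⇒lookup x∈X = if-⌊⌋⁺ (ρ (X - x) ≟ ρ X) ρX-x≡ρX

  cyc⊆ : cyc ρ X ⊆ X
  cyc⊆ {X} {x} x∈ with lookup X x in eq | ∈tabulate⁻ x∈
  ... | true | _ = lookup⇒[]= x X eq

  X⊆clX : X ⊆ cl ρ X
  X⊆clX x∈X = ∈cl⁺ (ρ-mono (∪⁅⁆⊆ ⊆-refl x∈X))

  ρ-cl : ∀ X → ρ (cl ρ X) ≡ ρ X
  ρ-cl X = ≤-antisym (≤-trans (ρ-mono (q⊆p∪q X _)) (ρ-∪-absorb (≤-reflexive ∘ ∈cl⁻))) (ρ-mono X⊆clX)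

  cl-mono : X ⊆ Y → cl ρ X ⊆ cl ρ Y
  cl-mono {X} {Y} X⊆Y {x} x∈clX = ∈cl⁺ (+-cancelʳ-≤ (ρ X) _ _ (begin
    ρ (Y ∪ ⁅ x ⁆) + ρ X    ≤⟨ ρ-diminishing x X⊆Y ⟩
    ρ Y + ρ (X ∪ ⁅ x ⁆)    ≡⟨ cong (ρ Y +_) (∈cl⁻ x∈clX) ⟩
    ρ Y + ρ X              ∎))
    where open ≤-Reasoning

  cl-idem : ∀ X → cl ρ (cl ρ X) ≡ cl ρ X
  cl-idem X = ⊆-antisym clclX⊆clX X⊆clX
    where
    clclX⊆clX : cl ρ (cl ρ X) ⊆ cl ρ X
    clclX⊆clX {x} x∈ = ∈cl⁺ (begin
      ρ (X ∪ ⁅ x ⁆)          ≤⟨ ρ-mono (∪-monoˡ-⊆ X⊆clX) ⟩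
      ρ (cl ρ X ∪ ⁅ x ⁆)     ≡⟨ ∈cl⁻ x∈ ⟩
      ρ (cl ρ X)             ≡⟨ ρ-cl X ⟩
      ρ X                    ∎)
      where open ≤-Reasoning

  cl-⊆-flat : X ⊆ F → cl ρ F ≡ F → cl ρ X ⊆ F
  cl-⊆-flat X⊆F clF≡F = subst (cl ρ _ ⊆_) clF≡F (cl-mono X⊆F)

  flat⊂⇒ρ< : cl ρ F ≡ F → F ⊂ Y → ρ F < ρ Y
  flat⊂⇒ρ< {F} clF≡F (F⊆Y , y , y∈Y , y∉F) =
    ≤-trans (∉cl⇒ρ< (y∉F ∘ subst (y ∈_) clF≡F)) (ρ-mono (∪-⊆ F⊆Y (x∈p⇒⁅x⁆⊆p y∈Y)))

  Cyclic : Subset n → Set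
  Cyclic C = ∀ {x} → x ∈ C → ρ C ≤ ρ (C - x)

  cyclic-flat⇒cyclic : IsCyclicFlat ρ C → Cyclic C
  cyclic-flat⇒cyclic {C} (_ , cycC≡C) x∈C =
    ≤-reflexive (sym (∈cyc⁻ (subst (_ ∈_) (sym cycC≡C) x∈C)))

  cyclic-⊆ : ∀ {x} → x ∈ C → C ⊆ D → ρ C ≤ ρ (C - x) → ρ D ≤ ρ (D - x)
  cyclic-⊆ {C} {D} {x} x∈C C⊆D ρC≤ = +-cancelʳ-≤ (ρ (C - x)) _ _ (begin
    ρ D + ρ (C - x)                   ≡⟨ cong (λ E → ρ E + ρ (C - x)) (x∈p⇒p-x∪⁅x⁆≡p (C⊆D x∈C)) ⟨
    ρ ((D - x) ∪ ⁅ x ⁆) + ρ (C - x)   ≤⟨ ρ-diminishing x (p⊆q⇒p-x⊆q-x C⊆D) ⟩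
    ρ (D - x) + ρ ((C - x) ∪ ⁅ x ⁆)   ≡⟨ cong (λ E → ρ (D - x) + ρ E) (x∈p⇒p-x∪⁅x⁆≡p x∈C) ⟩
    ρ (D - x) + ρ C                   ≤⟨ +-monoʳ-≤ (ρ (D - x)) ρC≤ ⟩
    ρ (D - x) + ρ (C - x)             ∎)
    where open ≤-Reasoning

  ∪-cyclic : Cyclic C → Cyclic D → Cyclic (C ∪ D)
  ∪-cyclic {C} {D} C-cyclic D-cyclic x∈ with x∈p∪q⁻ C D x∈
  ... | inj₁ x∈C = cyclic-⊆ x∈C (p⊆p∪q D) (C-cyclic x∈C)
  ... | inj₂ x∈D = cyclic-⊆ x∈D (q⊆p∪q C D) (D-cyclic x∈D)

  cl-cyclic : Cyclic C → IsCyclicFlat ρ (cl ρ C)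
  cl-cyclic {C} C-cyclic =
    cl-idem C , ⊆-antisym cyc⊆ (λ x∈ → ∈cyc⁺ x∈ (≤-antisym (ρ-mono (p─q⊆p _ _)) (clC-cyclic x∈)))
    where
    clC-cyclic : Cyclic (cl ρ C)
    clC-cyclic {x} x∈clC with x ∈? C
    ... | yes x∈C = cyclic-⊆ x∈C X⊆clX (C-cyclic x∈C)
    ... | no  x∉C = begin
      ρ (cl ρ C)       ≡⟨ ρ-cl C ⟩
      ρ C              ≤⟨ ρ-mono (λ y∈C → x∈p∧x≢y⇒x∈p-y (X⊆clX y∈C) (λ { refl → x∉C y∈C })) ⟩
      ρ (cl ρ C - x)   ∎
      where open ≤-Reasoning

  η-∪⁅⁆ : ∀ {u} → u ∉ S → ρ (S ∪ ⁅ u ⁆) ≡ suc (ρ S) → η ρ (S ∪ ⁅ u ⁆) ≡ η ρ S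
  η-∪⁅⁆ u∉S ρS∪u≡ = cong₂ _∸_ (∣p∪⁅x⁆∣≡1+∣p∣ u∉S) ρS∪u≡

  η-minus-pair : ∀ {Z x y} → x ∈ Z → y ∈ Z → x ≢ y → ρ (Z - x - y) < ρ Z →
                 η ρ Z ≤ suc (η ρ (Z - x - y))
  η-minus-pair {Z} {x} {y} x∈Z y∈Z x≢y ρZ-x-y<ρZ = +-cancelʳ-≤ (suc (ρ (Z - x - y))) _ _ (begin
    η ρ Z + suc (ρ (Z - x - y))               ≤⟨ +-monoʳ-≤ (η ρ Z) ρZ-x-y<ρZ ⟩
    η ρ Z + ρ Z                               ≡⟨ η+ρ≡∣∣ Z ⟩
    ∣ Z ∣                                      ≡⟨ ∣p-x∣+1≡∣p∣ x∈Z ⟨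
    suc ∣ Z - x ∣                              ≡⟨ cong suc (∣p-x∣+1≡∣p∣ y∈Z-x) ⟨
    suc (suc ∣ Z - x - y ∣)                    ≡⟨ cong (λ k → suc (suc k)) (η+ρ≡∣∣ (Z - x - y)) ⟨
    suc (suc (η ρ (Z - x - y) + ρ (Z - x - y))) ≡⟨ cong suc (+-suc _ _) ⟨
    suc (η ρ (Z - x - y)) + suc (ρ (Z - x - y)) ∎)
    where
    open ≤-Reasoning
    y∈Z-x : y ∈ Z - x
    y∈Z-x = x∈p∧x≢y⇒x∈p-y y∈Z (x≢y ∘ sym)

  augment : ρ S < ρ U → ∃ λ u → u ∈ U × u ∉ S × ρ (S ∪ ⁅ u ⁆) ≡ suc (ρ S)
  augment {S} {U} ρS<ρU with any? (λ u → (u ∈? U) ×-dec (ρ (S ∪ ⁅ u ⁆) ≟ suc (ρ S)))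
  ... | yes (u , u∈U , ρS∪u≡) = u , u∈U , u∉S , ρS∪u≡
    where
    u∉S : u ∉ S
    u∉S u∈S = n≮n (ρ S) (≤-trans (≤-reflexive (sym ρS∪u≡)) (ρ-mono (∪⁅⁆⊆ ⊆-refl u∈S)))
  ... | no ∄u =
    contradiction (≤-trans ρS<ρU (≤-trans (ρ-mono (q⊆p∪q S U)) (ρ-∪-absorb absorbs))) (n≮n (ρ S))
    where
    absorbs : ∀ {u} → u ∈ U → ρ (S ∪ ⁅ u ⁆) ≤ ρ S
    absorbs u∈U = ≤-pred (≤∧≢⇒< (ρ-∪⁅⁆-≤ S _) (λ ρS∪u≡ → ∄u (_ , u∈U , ρS∪u≡)))

  augment-by : ∀ k → k + ρ S ≤ ρ U → S ⊆ U →
              ∃ λ P → S ⊆ P × P ⊆ U × ρ P ≡ k + ρ S × η ρ P ≡ η ρ S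
  augment-by zero    _           S⊆U = _ , ⊆-refl , S⊆U , refl , refl
  augment-by {S} {U} (suc k) 1+k+ρS≤ρU S⊆U
    with augment {S} {U} (≤-trans (s≤s (m≤n+m (ρ S) k)) 1+k+ρS≤ρU)
  ... | u , u∈U , u∉S , ρS∪u≡
    with augment-by k k+ρS∪u≤ρU (∪-⊆ S⊆U (x∈p⇒⁅x⁆⊆p u∈U))
    where
    k+ρS∪u≤ρU : k + ρ (S ∪ ⁅ u ⁆) ≤ ρ U
    k+ρS∪u≤ρU = subst (_≤ ρ U) (sym (trans (cong (k +_) ρS∪u≡) (+-suc k (ρ S)))) 1+k+ρS≤ρU
  ... | P , S∪u⊆P , P⊆U , ρP≡ , ηP≡ =
    P , ⊆-trans (p⊆p∪q _) S∪u⊆P , P⊆U ,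
    trans ρP≡ (trans (cong (k +_) ρS∪u≡) (+-suc k (ρ S))) , trans ηP≡ (η-∪⁅⁆ u∉S ρS∪u≡)

  augment-to-corank : ∀ j → j + ρ S ≤ ρ U → S ⊆ U →
                    ∃ λ P → S ⊆ P × P ⊆ U × j + ρ P ≡ ρ U × η ρ P ≡ η ρ S
  augment-to-corank {S} {U} j j+ρS≤ρU S⊆U =
    let k = ρ U ∸ (j + ρ S)
        j+[k+ρS]≡ρU = trans (reorder j k (ρ S)) (m+[n∸m]≡n j+ρS≤ρU)
        P , S⊆P , P⊆U , ρP≡ , ηP≡ = augment-by k (≤-trans (m≤n+m _ j) (≤-reflexive j+[k+ρS]≡ρU)) S⊆U
    in P , S⊆P , P⊆U , trans (cong (j +_) ρP≡) j+[k+ρS]≡ρU , ηP≡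
    where
    reorder : ∀ j k r → j + (k + r) ≡ j + r + k
    reorder = solve-∀

module BinaryMatroid {n m : ℕ} {ρ : RankFn n} (M : IsMatroid ρ)
                     (A : Fin n → Vec Bool m) (rk : ∀ X → IsRankOf A X (ρ X)) where
  open Matroid M

  private
    variable
      S U X Y Z Z′ : Subset n
      a b c e u : Fin n
      v w : Vec Bool m

  sumCols-⁅⁆ : ∀ x → sumCols A ⁅ x ⁆ ≡ A x
  sumCols-⁅⁆ x = begin
    sumCols A ⁅ x ⁆               ≡⟨ cong (sumCols A) (∪-identityˡ ⁅ x ⁆) ⟨
    sumCols A (⊥ ∪ ⁅ x ⁆)         ≡⟨ sumCols-∪⁅⁆ A ∉⊥ ⟩
    sumCols A ⊥ ⊕ A x             ≡⟨ cong (_⊕ A x) (sumCols-⊥ A) ⟩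
    zeroVec m ⊕ A x               ≡⟨ trans (⊕-comm _ (A x)) (⊕-identityʳ (A x)) ⟩
    A x                           ∎
    where open ≡-Reasoning

  sumCols-remove : ∀ {x} → x ∈ U → sumCols A (U - x) ⊕ A x ≡ sumCols A U
  sumCols-remove {U} {x} x∈U =
    trans (sym (sumCols-∪⁅⁆ A x∉p-x)) (cong (sumCols A) (x∈p⇒p-x∪⁅x⁆≡p x∈U))

  Spans : Subset n → Vec Bool m → Set
  Spans X v = ∃ λ U → U ⊆ X × sumCols A U ≡ v

  spans? : ∀ X v → Dec (Spans X v)
  spans? X v = anySubset? (λ U → (U ⊆? X) ×-dec ≡-dec Bool._≟_ (sumCols A U) v)

  spans-0 : Spans X (zeroVec m)
  spans-0 = ⊥ , ⊥⊆ , sumCols-⊥ A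

  spans-el : ∀ {x} → x ∈ X → Spans X (A x)
  spans-el {x = x} x∈X = ⁅ x ⁆ , x∈p⇒⁅x⁆⊆p x∈X , sumCols-⁅⁆ x

  spans-mono : X ⊆ Y → Spans X v → Spans Y v
  spans-mono X⊆Y (U , U⊆X , ΣU≡v) = U , ⊆-trans U⊆X X⊆Y , ΣU≡v

  spans-⊕ : Spans X v → Spans X w → Spans X (v ⊕ w)
  spans-⊕ (U , U⊆X , ΣU≡v) (V , V⊆X , ΣV≡w) =
    U △ V , ⊆-trans (p△q⊆p∪q U V) (∪-⊆ U⊆X V⊆X) , trans (sumCols-△ A U V) (cong₂ _⊕_ ΣU≡v ΣV≡w)

  spans-sumCols : (∀ {u} → u ∈ U → Spans X (A u)) → Spans X (sumCols A U)
  spans-sumCols = sumCols-closed (Spans _) spans-0 spans-⊕ A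

  indep-⊆ : Y ⊆ X → LinIndep A X → LinIndep A Y
  indep-⊆ Y⊆X indX T T⊆Y = indX T (⊆-trans T⊆Y Y⊆X)

  indep-∪⁅⁆ : LinIndep A Y → ¬ Spans Y (A u) → LinIndep A (Y ∪ ⁅ u ⁆)
  indep-∪⁅⁆ {Y} {u} indY ¬span T T⊆ T≢∅ ΣT≡0 with u ∈? T
  ... | yes u∈T = ¬span (T - u , p⊆q∪⁅x⁆⇒p-x⊆q T⊆ , ⊕≡0⇒≡ (trans (sumCols-remove u∈T) ΣT≡0))
  ... | no  u∉T = indY T (p⊆q∪⁅x⁆∧x∉p⇒p⊆q T⊆ u∉T) T≢∅ ΣT≡0

  indep⇒¬spans[Y-x] : ∀ {x} → LinIndep A Y → x ∈ Y → ¬ Spans (Y - x) (A x)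
  indep⇒¬spans[Y-x] {Y} {x} indY x∈Y (W , W⊆Y-x , ΣW≡Ax) =
    indY (W ∪ ⁅ x ⁆) (∪⁅⁆⊆ (⊆-trans W⊆Y-x (p─q⊆p Y _)) x∈Y) (x , x∈p∪⁅x⁆ W x) (begin
      sumCols A (W ∪ ⁅ x ⁆)   ≡⟨ sumCols-∪⁅⁆ A (x∉p-x ∘ W⊆Y-x) ⟩
      sumCols A W ⊕ A x       ≡⟨ cong (_⊕ A x) ΣW≡Ax ⟩
      A x ⊕ A x               ≡⟨ ⊕-self (A x) ⟩
      zeroVec m               ∎)
    where open ≡-Reasoning

  spans⇒ρ≤ : ∀ {x} → Spans X (A x) → ρ (X ∪ ⁅ x ⁆) ≤ ρ X
  spans⇒ρ≤ {X} {x} (U , U⊆X , ΣU≡Ax) with rk (X ∪ ⁅ x ⁆)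
  ... | (Y , Y⊆ , indY , ∣Y∣≡ρ) , _ with x ∈? Y
  ...   | no  x∉Y = subst (_≤ ρ X) ∣Y∣≡ρ (proj₂ (rk X) Y (p⊆q∪⁅x⁆∧x∉p⇒p⊆q Y⊆ x∉Y) indY)
  ...   | yes x∈Y with any? (λ u → (u ∈? U) ×-dec ¬? (spans? (Y - x) (A u)))
  ...     | yes (u , u∈U , ¬span) = begin
    ρ (X ∪ ⁅ x ⁆)               ≡⟨ ∣Y∣≡ρ ⟨
    ∣ Y ∣                       ≡⟨ ∣p-x∣+1≡∣p∣ x∈Y ⟨
    suc ∣ Y - x ∣               ≡⟨ ∣p∪⁅x⁆∣≡1+∣p∣ (¬span ∘ spans-el) ⟨
    ∣ (Y - x) ∪ ⁅ u ⁆ ∣         ≤⟨ proj₂ (rk X) _ (∪⁅⁆⊆ (p⊆q∪⁅x⁆⇒p-x⊆q Y⊆) (U⊆X u∈U))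
                                     (indep-∪⁅⁆ (indep-⊆ (p─q⊆p Y _) indY) ¬span) ⟩
    ρ X                         ∎
    where open ≤-Reasoning
  ...     | no ∄u =
    contradiction (subst (Spans (Y - x)) ΣU≡Ax (spans-sumCols spanned)) (indep⇒¬spans[Y-x] indY x∈Y)
    where
    spanned : ∀ {u} → u ∈ U → Spans (Y - x) (A u)
    spanned {u} u∈U with spans? (Y - x) (A u)
    ... | yes span = span
    ... | no ¬span = contradiction (u , u∈U , ¬span) ∄u

  ρ≤⇒spans : ∀ {x} → ρ (X ∪ ⁅ x ⁆) ≤ ρ X → Spans X (A x)
  ρ≤⇒spans {X} {x} ρX∪x≤ρX with x ∈? X
  ... | yes x∈X = spans-el x∈X
  ... | no  x∉X with rk X
  ...   | (Y , Y⊆X , indY , ∣Y∣≡ρX) , _ with spans? Y (A x)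
  ...     | yes span = spans-mono Y⊆X span
  ...     | no ¬span = contradiction (begin-strict
    ρ X                  ≡⟨ ∣Y∣≡ρX ⟨
    ∣ Y ∣                <⟨ n<1+n _ ⟩
    suc ∣ Y ∣            ≡⟨ ∣p∪⁅x⁆∣≡1+∣p∣ (x∉X ∘ Y⊆X) ⟨
    ∣ Y ∪ ⁅ x ⁆ ∣        ≤⟨ proj₂ (rk (X ∪ ⁅ x ⁆)) _ (∪-monoˡ-⊆ Y⊆X) (indep-∪⁅⁆ indY ¬span) ⟩
    ρ (X ∪ ⁅ x ⁆)        ≤⟨ ρX∪x≤ρX ⟩
    ρ X                  ∎) (n≮n (ρ X))
    where open ≤-Reasoning

  spans⇒∈cl : ∀ {x} → Spans X (A x) → x ∈ cl ρ X
  spans⇒∈cl = ∈cl⁺ ∘ spans⇒ρ≤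

  ∈cl⇒spans : ∀ {x} → x ∈ cl ρ X → Spans X (A x)
  ∈cl⇒spans = ρ≤⇒spans ∘ ≤-reflexive ∘ ∈cl⁻

  spans-∪⁅⁆⁻ : Spans (X ∪ ⁅ a ⁆) v → Spans X v ⊎ Spans X (v ⊕ A a)
  spans-∪⁅⁆⁻ {X} {a} {v} (U , U⊆ , ΣU≡v) with a ∈? U
  ... | yes a∈U = inj₂ (U - a , p⊆q∪⁅x⁆⇒p-x⊆q U⊆ , (begin
    sumCols A (U - a)             ≡⟨ ⊕-cancelʳ _ (A a) ⟨
    sumCols A (U - a) ⊕ A a ⊕ A a ≡⟨ cong (_⊕ A a) (trans (sumCols-remove a∈U) ΣU≡v) ⟩
    v ⊕ A a                       ∎))
    where open ≡-Reasoning
  ... | no  a∉U = inj₁ (U , p⊆q∪⁅x⁆∧x∉p⇒p⊆q U⊆ a∉U , ΣU≡v)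

  spans-∪⁅⁆⁺ : Spans X (v ⊕ A a) → Spans (X ∪ ⁅ a ⁆) v
  spans-∪⁅⁆⁺ {X} {v} {a} span = subst (Spans (X ∪ ⁅ a ⁆)) (⊕-cancelʳ v (A a))
    (spans-⊕ (spans-mono (p⊆p∪q _) span) (spans-el (x∈p∪⁅x⁆ X a)))

  zero-sum⇒cyclic : ∀ {K} → sumCols A K ≡ zeroVec m → Cyclic K
  zero-sum⇒cyclic {K} ΣK≡0 {k} k∈K = subst (λ L → ρ L ≤ ρ (K - k)) (x∈p⇒p-x∪⁅x⁆≡p k∈K)
    (spans⇒ρ≤ (K - k , ⊆-refl , ⊕≡0⇒≡ (trans (sumCols-remove k∈K) ΣK≡0)))

  IndepOver : Subset n → Fin n → Fin n → Set
  IndepOver S a b = 2 + ρ S ≤ ρ ((S ∪ ⁅ a ⁆) ∪ ⁅ b ⁆)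

  indepOver⇒¬spans : IndepOver S a b → ¬ Spans (S ∪ ⁅ a ⁆) (A b)
  indepOver⇒¬spans {S} {a} 2+ρS≤ span =
    n≮n _ (≤-trans 2+ρS≤ (≤-trans (spans⇒ρ≤ span) (ρ-∪⁅⁆-≤ S a)))

  -- Binarity: over S, the line through a and b has only one further point, a + b; this is the
  -- absence of a U₂,₄ minor.
  third-point : IndepOver S a b → IndepOver S a c → IndepOver S b c →
                ρ (((S ∪ ⁅ a ⁆) ∪ ⁅ b ⁆) ∪ ⁅ c ⁆) ≤ 2 + ρ S → Spans S (A a ⊕ A b ⊕ A c)
  third-point {S} {a} {b} {c} ab ac bc c-on-ab
    with spans-∪⁅⁆⁻ (ρ≤⇒spans (≤-trans c-on-ab ab))
  ... | inj₁ span = contradiction span (indepOver⇒¬spans ac)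
  ... | inj₂ span with spans-∪⁅⁆⁻ span
  ...   | inj₁ span′ = contradiction (spans-∪⁅⁆⁺ span′) (indepOver⇒¬spans bc)
  ...   | inj₂ span′ = subst (Spans S) (begin
    A c ⊕ A b ⊕ A a     ≡⟨ ⊕-comm _ (A a) ⟩
    A a ⊕ (A c ⊕ A b)   ≡⟨ cong (A a ⊕_) (⊕-comm (A c) (A b)) ⟩
    A a ⊕ (A b ⊕ A c)   ≡⟨ ⊕-assoc (A a) (A b) (A c) ⟨
    A a ⊕ A b ⊕ A c     ∎) span′
    where open ≡-Reasoning

  third-points-parallel :
    IndepOver S a b → IndepOver S a c → IndepOver S b c → IndepOver S a e → IndepOver S b e →
    ρ (((S ∪ ⁅ a ⁆) ∪ ⁅ b ⁆) ∪ ⁅ c ⁆) ≤ 2 + ρ S → ρ (((S ∪ ⁅ a ⁆) ∪ ⁅ b ⁆) ∪ ⁅ e ⁆) ≤ 2 + ρ S →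
    e ∈ cl ρ (S ∪ ⁅ c ⁆)
  third-points-parallel {S} {a} {b} {c} {e} ab ac bc ae be c-on-ab e-on-ab =
    spans⇒∈cl (spans-∪⁅⁆⁺ (subst (Spans S) sum≡
      (spans-⊕ (third-point ab ac bc c-on-ab) (third-point ab ae be e-on-ab))))
    where
    sum≡ : (A a ⊕ A b ⊕ A c) ⊕ (A a ⊕ A b ⊕ A e) ≡ A e ⊕ A c
    sum≡ = trans (⊕-cancelˡ-common (A a ⊕ A b) (A c) (A e)) (⊕-comm (A c) (A e))

  -- The cycle U ∪ e, with U ⊆ X spanning e, makes cl (Z′ ∪ U ∪ e) a cyclic flat strictly above
  -- Z′ inside Z; by the covering it is Z.
  covered-closure : CoveredBy ρ Z′ Z → Z′ ⊆ X → X ⊆ Z → e ∈ Z → e ∉ X → e ∈ cl ρ X → ρ Z ≤ ρ X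
  covered-closure {Z′} {Z} {X} {e} (cfZ′ , (clZ≡Z , _) , _ , noneBetween) Z′⊆X X⊆Z e∈Z e∉X e∈clX
    with ∈cl⇒spans e∈clX
  ... | U , U⊆X , ΣU≡Ae = begin
    ρ Z              ≤⟨ ρ-mono Z⊆W ⟩
    ρ W              ≡⟨ ρ-cl C ⟩
    ρ C              ≤⟨ ρ-mono (∪-⊆ (⊆-trans Z′⊆X (p⊆p∪q _)) (∪-monoˡ-⊆ U⊆X)) ⟩
    ρ (X ∪ ⁅ e ⁆)    ≡⟨ ∈cl⁻ e∈clX ⟩
    ρ X              ∎
    where
    open ≤-Reasoning
    K C W : Subset n
    K = U ∪ ⁅ e ⁆
    C = Z′ ∪ K
    W = cl ρ C
    K-zeroSum : sumCols A K ≡ zeroVec m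
    K-zeroSum = trans (sumCols-∪⁅⁆ A (e∉X ∘ U⊆X)) (trans (cong (_⊕ A e) ΣU≡Ae) (⊕-self (A e)))
    cfW : IsCyclicFlat ρ W
    cfW = cl-cyclic (∪-cyclic (cyclic-flat⇒cyclic cfZ′) (zero-sum⇒cyclic K-zeroSum))
    Z′⊂W : Z′ ⊂ W
    Z′⊂W = ⊆-trans (p⊆p∪q K) X⊆clX , e , X⊆clX (q⊆p∪q Z′ K (x∈p∪⁅x⁆ U e)) , e∉X ∘ Z′⊆X
    W⊆Z : W ⊆ Z
    W⊆Z = cl-⊆-flat (∪-⊆ (⊆-trans Z′⊆X X⊆Z) (∪⁅⁆⊆ (⊆-trans U⊆X X⊆Z) e∈Z)) clZ≡Z
    Z⊆W : Z ⊆ W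
    Z⊆W = ⊆∧⊄⇒⊇ W⊆Z (noneBetween W cfW Z′⊂W)

  covered-rank-step : CoveredBy ρ Z′ Z → Z′ ⊆ X → X ⊆ Z → ρ X < ρ Z → e ∈ Z → e ∉ X →
                      ρ (X ∪ ⁅ e ⁆) ≡ suc (ρ X)
  covered-rank-step {X = X} {e = e} Z′⋖Z Z′⊆X X⊆Z ρX<ρZ e∈Z e∉X = ≤-antisym (ρ-∪⁅⁆-≤ X e)
    (∉cl⇒ρ< (λ e∈clX → n≮n _ (≤-trans ρX<ρZ (covered-closure Z′⋖Z Z′⊆X X⊆Z e∈Z e∉X e∈clX))))

  series-pair : CoveredBy ρ Z′ Z → 2 + ρ Z′ ≤ ρ Z →
               ∃₂ λ x y → x ∈ Z × y ∈ Z × x ≢ y × ρ (Z - x - y) < ρ Z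
  series-pair {Z′} {Z} Z′⋖Z@(_ , _ , (Z′⊆Z , _) , _) gap with augment-to-corank 2 gap Z′⊆Z
  ... | S , Z′⊆S , S⊆Z , 2+ρS≡ρZ , _ with augment {S} {Z} (≤-trans (n≤1+n _) (≤-reflexive 2+ρS≡ρZ))
  ... | x , x∈Z , x∉S , ρS∪x≡
    with augment {S ∪ ⁅ x ⁆} {Z} (subst (_< ρ Z) (sym ρS∪x≡) (≤-reflexive 2+ρS≡ρZ))
  ... | y , y∈Z , y∉S∪x , _ = x , y , x∈Z , y∈Z , x≢y , (begin-strict
    ρ (Z - x - y)     ≤⟨ ρZ-x-y≤ ⟩
    suc (ρ S)         <⟨ n<1+n _ ⟩
    2 + ρ S           ≡⟨ 2+ρS≡ρZ ⟩
    ρ Z               ∎)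
    where
    open ≤-Reasoning
    x≢y : x ≢ y
    x≢y x≡y = y∉S∪x (subst (_∈ S ∪ ⁅ x ⁆) x≡y (x∈p∪⁅x⁆ S x))
    y∉S : y ∉ S
    y∉S = y∉S∪x ∘ p⊆p∪q _
    ρS<ρZ : ρ S < ρ Z
    ρS<ρZ = ≤-trans (n≤1+n _) (≤-reflexive 2+ρS≡ρZ)
    indep-over : ∀ {u w} → u ∈ Z → w ∈ Z → u ∉ S → w ∉ S → u ≢ w → IndepOver S u w
    indep-over {u} {w} u∈Z w∈Z u∉S w∉S u≢w = ≤-reflexive (sym (begin-equality
      ρ ((S ∪ ⁅ u ⁆) ∪ ⁅ w ⁆)   ≡⟨ covered-rank-step Z′⋖Z (⊆-trans Z′⊆S (p⊆p∪q _)) (∪⁅⁆⊆ S⊆Z u∈Z)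
                                    ρS∪u<ρZ w∈Z (∉∪⁅⁆ w∉S (u≢w ∘ sym)) ⟩
      suc (ρ (S ∪ ⁅ u ⁆))        ≡⟨ cong suc ρS∪u≡ ⟩
      2 + ρ S                    ∎))
      where
      ρS∪u≡ : ρ (S ∪ ⁅ u ⁆) ≡ suc (ρ S)
      ρS∪u≡ = covered-rank-step Z′⋖Z Z′⊆S S⊆Z ρS<ρZ u∈Z u∉S
      ρS∪u<ρZ : ρ (S ∪ ⁅ u ⁆) < ρ Z
      ρS∪u<ρZ = subst (_< ρ Z) (sym ρS∪u≡) (≤-reflexive 2+ρS≡ρZ)
    on-plane : ∀ {u} → u ∈ Z → ρ (((S ∪ ⁅ x ⁆) ∪ ⁅ y ⁆) ∪ ⁅ u ⁆) ≤ 2 + ρ S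
    on-plane u∈Z = ≤-trans (ρ-mono (∪⁅⁆⊆ (∪⁅⁆⊆ (∪⁅⁆⊆ S⊆Z x∈Z) y∈Z) u∈Z)) (≤-reflexive (sym 2+ρS≡ρZ))
    ρZ-x-y≤ : ρ (Z - x - y) ≤ suc (ρ S)
    ρZ-x-y≤ with any? (λ e → (e ∈? Z - x - y) ×-dec ¬? (e ∈? S))
    ... | no ∄e = ≤-trans (ρ-mono Z-x-y⊆S) (n≤1+n _)
      where
      Z-x-y⊆S : Z - x - y ⊆ S
      Z-x-y⊆S {f} f∈ with f ∈? S
      ... | yes f∈S = f∈S
      ... | no  f∉S = contradiction (f , f∈ , f∉S) ∄e
    ... | yes (e , e∈ , e∉S) with x∈p-y-z⁻ e∈
    ...   | e∈Z , e≢x , e≢y = begin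
      ρ (Z - x - y)           ≤⟨ ρ-mono Z-x-y⊆ ⟩
      ρ (cl ρ (S ∪ ⁅ e ⁆))    ≡⟨ ρ-cl _ ⟩
      ρ (S ∪ ⁅ e ⁆)           ≤⟨ ρ-∪⁅⁆-≤ S e ⟩
      suc (ρ S)               ∎
      where
      xy : IndepOver S x y
      xy = indep-over x∈Z y∈Z x∉S y∉S x≢y
      Z-x-y⊆ : Z - x - y ⊆ cl ρ (S ∪ ⁅ e ⁆)
      Z-x-y⊆ {f} f∈ with f ∈? S | x∈p-y-z⁻ f∈
      ... | yes f∈S | _ = X⊆clX (p⊆p∪q _ f∈S)
      ... | no  f∉S | f∈Z , f≢x , f≢y = third-points-parallel xy
        (indep-over x∈Z e∈Z x∉S e∉S (e≢x ∘ sym)) (indep-over y∈Z e∈Z y∉S e∉S (e≢y ∘ sym))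
        (indep-over x∈Z f∈Z x∉S f∉S (f≢x ∘ sym)) (indep-over y∈Z f∈Z y∉S f∉S (f≢y ∘ sym))
        (on-plane e∈Z) (on-plane f∈Z)

  indepOver-∉cl : ρ (S ∪ ⁅ a ⁆) ≡ suc (ρ S) → b ∉ cl ρ (S ∪ ⁅ a ⁆) → IndepOver S a b
  indepOver-∉cl {S} {a} {b} ρS∪a≡ b∉ =
    subst (λ r → suc r ≤ ρ ((S ∪ ⁅ a ⁆) ∪ ⁅ b ⁆)) ρS∪a≡ (∉cl⇒ρ< b∉)

  third-hyperplane : 2 + ρ S ≡ ρ ⊤ → ρ (S ∪ ⁅ a ⁆) ≡ suc (ρ S) →
                     ρ ((S ∪ ⁅ a ⁆) ∪ ⁅ b ⁆) ≡ suc (ρ (S ∪ ⁅ a ⁆)) →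
                     ∃ λ H → ρ H < ρ ⊤ × cl ρ S ⊆ H × ⊤ ─ (cl ρ (S ∪ ⁅ a ⁆) ∪ cl ρ (S ∪ ⁅ b ⁆)) ⊆ H
  third-hyperplane {S} {a} {b} 2+ρS≡ρ⊤ ρS∪a≡ ρS∪a∪b≡
    with any? (λ c → c ∈? ⊤ ─ (cl ρ (S ∪ ⁅ a ⁆) ∪ cl ρ (S ∪ ⁅ b ⁆)))
  ... | no ∄c = cl ρ S , ρclS<ρ⊤ , ⊆-refl , λ c∈ → contradiction (_ , c∈) ∄c
    where
    ρclS<ρ⊤ : ρ (cl ρ S) < ρ ⊤
    ρclS<ρ⊤ = ≤-trans (≤-reflexive (cong suc (ρ-cl S))) (≤-trans (n≤1+n _) (≤-reflexive 2+ρS≡ρ⊤))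
  ... | yes (c , c∈) =
    cl ρ (S ∪ ⁅ c ⁆) , ρclS∪c<ρ⊤ , cl-mono (p⊆p∪q _) , λ j∈ → third-points-parallel ab
      (outside-a c∈) (outside-b c∈) (outside-a j∈) (outside-b j∈) (on-plane c) (on-plane _)
    where
    ab : IndepOver S a b
    ab = ≤-reflexive (sym (trans ρS∪a∪b≡ (cong suc ρS∪a≡)))
    ρS∪b≡ : ρ (S ∪ ⁅ b ⁆) ≡ suc (ρ S)
    ρS∪b≡ = ≤-antisym (ρ-∪⁅⁆-≤ S b) (≤-pred (begin
      2 + ρ S                    ≤⟨ ab ⟩
      ρ ((S ∪ ⁅ a ⁆) ∪ ⁅ b ⁆)    ≤⟨ ρ-mono (∪⁅⁆⊆ (∪⁅⁆⊆ (⊆-trans (p⊆p∪q _) (p⊆p∪q _)) (x∈p∪⁅x⁆ _ a))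
                                            (p⊆p∪q _ (x∈p∪⁅x⁆ S b))) ⟩
      ρ ((S ∪ ⁅ b ⁆) ∪ ⁅ a ⁆)    ≤⟨ ρ-∪⁅⁆-≤ _ a ⟩
      suc (ρ (S ∪ ⁅ b ⁆))        ∎))
      where open ≤-Reasoning
    outside-a : ∀ {j} → j ∈ ⊤ ─ (cl ρ (S ∪ ⁅ a ⁆) ∪ cl ρ (S ∪ ⁅ b ⁆)) → IndepOver S a j
    outside-a j∈ = indepOver-∉cl ρS∪a≡ (x∈p─q⇒x∉q j∈ ∘ p⊆p∪q _)
    outside-b : ∀ {j} → j ∈ ⊤ ─ (cl ρ (S ∪ ⁅ a ⁆) ∪ cl ρ (S ∪ ⁅ b ⁆)) → IndepOver S b j
    outside-b j∈ = indepOver-∉cl ρS∪b≡ (x∈p─q⇒x∉q j∈ ∘ q⊆p∪q _ _)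
    on-plane : ∀ j → ρ (((S ∪ ⁅ a ⁆) ∪ ⁅ b ⁆) ∪ ⁅ j ⁆) ≤ 2 + ρ S
    on-plane j = ≤-trans (ρ-mono ⊆⊤) (≤-reflexive (sym 2+ρS≡ρ⊤))
    ρclS∪c<ρ⊤ : ρ (cl ρ (S ∪ ⁅ c ⁆)) < ρ ⊤
    ρclS∪c<ρ⊤ = ≤-trans (s≤s (≤-trans (≤-reflexive (ρ-cl _)) (ρ-∪⁅⁆-≤ S c))) (≤-reflexive 2+ρS≡ρ⊤)

  module _ {d : ℕ} (dmin : ∀ X → ρ (⊤ ─ X) < ρ ⊤ → d ≤ ∣ X ∣) where

    d≤∣⊤─H∣ : ∀ {H} → ρ H < ρ ⊤ → d ≤ ∣ ⊤ ─ H ∣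
    d≤∣⊤─H∣ {H} ρH<ρ⊤ = dmin (⊤ ─ H) (≤-trans (s≤s (ρ-mono (p─[p─q]⊆q ⊤ H))) ρH<ρ⊤)

    -- Every element outside F lies outside at most two of H₁, H₂, H₃.
    three-hyperplanes : ∀ {F H₁ H₂ H₃} → F ⊆ H₁ → F ⊆ H₂ → F ⊆ H₃ → ⊤ ─ (H₁ ∪ H₂) ⊆ H₃ →
                        ρ H₁ < ρ ⊤ → ρ H₂ < ρ ⊤ → ρ H₃ < ρ ⊤ → 3 * d ≤ 2 * ∣ ⊤ ─ F ∣
    three-hyperplanes {F} {H₁} {H₂} {H₃} F⊆H₁ F⊆H₂ F⊆H₃ R⊆H₃ ρH₁< ρH₂< ρH₃< =
      3d≤2D (d≤∣⊤─H∣ ρH₁<) (d≤∣⊤─H∣ ρH₂<) (d≤∣⊤─H∣ ρH₃<)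
        (p∪q⊆r∧p∩q⊆s⇒∣p∣+∣q∣≤∣r∣+∣s∣ (∪-⊆ (q⊆r⇒p─r⊆p─q F⊆H₁) (q⊆r⇒p─r⊆p─q F⊆H₂)) X₁∩X₂⊆R)
        (≤-trans (p∪q⊆r∧p∩q⊆s⇒∣p∣+∣q∣≤∣r∣+∣s∣ X₃∪R⊆D X₃∩R⊆⊥)
                 (≤-reflexive (trans (cong (∣ ⊤ ─ F ∣ +_) (∣⊥∣≡0 n)) (+-identityʳ _))))
      where
      X₁∩X₂⊆R : (⊤ ─ H₁) ∩ (⊤ ─ H₂) ⊆ ⊤ ─ (H₁ ∪ H₂)
      X₁∩X₂⊆R x∈ with x∈p∩q⁻ (⊤ ─ H₁) (⊤ ─ H₂) x∈
      ... | x∈X₁ , x∈X₂ = x∈p∧x∉q⇒x∈p─q ∈⊤ (∉∪ (x∈p─q⇒x∉q x∈X₁) (x∈p─q⇒x∉q x∈X₂))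
      X₃∪R⊆D : (⊤ ─ H₃) ∪ (⊤ ─ (H₁ ∪ H₂)) ⊆ ⊤ ─ F
      X₃∪R⊆D = ∪-⊆ (q⊆r⇒p─r⊆p─q F⊆H₃) (q⊆r⇒p─r⊆p─q (⊆-trans F⊆H₁ (p⊆p∪q H₂)))
      X₃∩R⊆⊥ : (⊤ ─ H₃) ∩ (⊤ ─ (H₁ ∪ H₂)) ⊆ ⊥
      X₃∩R⊆⊥ x∈ with x∈p∩q⁻ (⊤ ─ H₃) _ x∈
      ... | x∈X₃ , x∈R = contradiction (R⊆H₃ x∈R) (x∈p─q⇒x∉q x∈X₃)

    3d≤2∣⊤─cl∣ : 2 + ρ S ≡ ρ ⊤ → 3 * d ≤ 2 * ∣ ⊤ ─ cl ρ S ∣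
    3d≤2∣⊤─cl∣ {S} 2+ρS≡ρ⊤ with augment {S} {⊤} (≤-trans (n≤1+n _) (≤-reflexive 2+ρS≡ρ⊤))
    ... | a , _ , _ , ρS∪a≡
      with augment {S ∪ ⁅ a ⁆} {⊤} (subst (_< ρ ⊤) (sym ρS∪a≡) (≤-reflexive 2+ρS≡ρ⊤))
    ... | b , _ , _ , ρS∪a∪b≡ with third-hyperplane 2+ρS≡ρ⊤ ρS∪a≡ ρS∪a∪b≡
    ... | H , ρH<ρ⊤ , clS⊆H , R⊆H =
      three-hyperplanes (cl-mono (p⊆p∪q _)) (cl-mono (p⊆p∪q _)) clS⊆H R⊆H
        (line<ρ⊤ a) (line<ρ⊤ b) ρH<ρ⊤
      where
      line<ρ⊤ : ∀ x → ρ (cl ρ (S ∪ ⁅ x ⁆)) < ρ ⊤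
      line<ρ⊤ x = ≤-trans (s≤s (≤-trans (≤-reflexive (ρ-cl _)) (ρ-∪⁅⁆-≤ S x))) (≤-reflexive 2+ρS≡ρ⊤)

    distance-bound : 2 + ρ X ≤ ρ ⊤ → 3 * d + 2 * η ρ X ≤ 2 * (2 + η ρ ⊤)
    distance-bound {X} 2+ρX≤ρ⊤ with augment-to-corank 2 2+ρX≤ρ⊤ ⊆⊤
    ... | S , _ , _ , 2+ρS≡ρ⊤ , ηS≡ηX = begin
      3 * d + 2 * η ρ X                ≤⟨ +-monoˡ-≤ (2 * η ρ X) (3d≤2∣⊤─cl∣ 2+ρS≡ρ⊤) ⟩
      2 * ∣ ⊤ ─ cl ρ S ∣ + 2 * η ρ X   ≡⟨ *-distribˡ-+ 2 ∣ ⊤ ─ cl ρ S ∣ (η ρ X) ⟨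
      2 * (∣ ⊤ ─ cl ρ S ∣ + η ρ X)     ≤⟨ *-monoʳ-≤ 2 (+-cancelʳ-≤ (ρ S) _ _ D+ηX+ρS≤) ⟩
      2 * (2 + η ρ ⊤)                  ∎
      where
      open ≤-Reasoning
      D+ηX+ρS≤ : ∣ ⊤ ─ cl ρ S ∣ + η ρ X + ρ S ≤ 2 + η ρ ⊤ + ρ S
      D+ηX+ρS≤ = begin
        ∣ ⊤ ─ cl ρ S ∣ + η ρ X + ρ S      ≡⟨ +-assoc _ (η ρ X) (ρ S) ⟩
        ∣ ⊤ ─ cl ρ S ∣ + (η ρ X + ρ S)    ≡⟨ cong (λ t → ∣ ⊤ ─ cl ρ S ∣ + (t + ρ S)) ηS≡ηX ⟨
        ∣ ⊤ ─ cl ρ S ∣ + (η ρ S + ρ S)    ≡⟨ cong (∣ ⊤ ─ cl ρ S ∣ +_) (η+ρ≡∣∣ S) ⟩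
        ∣ ⊤ ─ cl ρ S ∣ + ∣ S ∣             ≤⟨ p∪q⊆r∧p∩q⊆s⇒∣p∣+∣q∣≤∣r∣+∣s∣ ⊆⊤ D∩S⊆⊥ ⟩
        ∣ ⊤ {n} ∣ + ∣ ⊥ {n} ∣             ≡⟨ trans (cong (∣ ⊤ {n} ∣ +_) (∣⊥∣≡0 n)) (+-identityʳ _) ⟩
        ∣ ⊤ {n} ∣                         ≡⟨ η+ρ≡∣∣ ⊤ ⟨
        η ρ ⊤ + ρ ⊤                       ≡⟨ cong (η ρ ⊤ +_) 2+ρS≡ρ⊤ ⟨
        η ρ ⊤ + (2 + ρ S)                 ≡⟨ +-assoc (η ρ ⊤) 2 (ρ S) ⟨
        η ρ ⊤ + 2 + ρ S                   ≡⟨ cong (_+ ρ S) (+-comm (η ρ ⊤) 2) ⟩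
        2 + η ρ ⊤ + ρ S                   ∎
        where
        D∩S⊆⊥ : (⊤ ─ cl ρ S) ∩ S ⊆ ⊥
        D∩S⊆⊥ x∈ with x∈p∩q⁻ (⊤ ─ cl ρ S) S x∈
        ... | x∈D , x∈S = contradiction (X⊆clX x∈S) (x∈p─q⇒x∉q x∈D)

    covered-with-gap⇒d≤4 : CoveredBy ρ Z′ Z → 2 + ρ Z′ ≤ ρ Z → ρ Z < ρ ⊤ →
                         d ≡ η ρ ⊤ + 1 ∸ η ρ Z → d ≤ 4
    covered-with-gap⇒d≤4 Z′⋖Z gap ρZ<ρ⊤ d≡ =
      let x , y , x∈Z , y∈Z , x≢y , ρZ-x-y<ρZ = series-pair Z′⋖Z gap
      in d≤4-arithmetic (distance-bound (≤-trans (s≤s ρZ-x-y<ρZ) ρZ<ρ⊤))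
                        (η-minus-pair x∈Z y∈Z x≢y ρZ-x-y<ρZ) d≡

proposition9p3 : (n k d : ℕ) (ρ : RankFn n) → IsMatroid ρ → Binary ρ → NonDegenerate ρ
    → ρ ⊤ ≡ k → IsMinDistance ρ d
    → (Zd : Subset n) → IsCoatom ρ Zd → d ≡ η ρ ⊤ + 1 ∸ η ρ Zd
    → ¬ Blunt ρ Zd → d ≤ 4
-- Non-degeneracy and the value k of the rank are not needed.
proposition9p3 n k d ρ M (_ , A , rk) _ _ (_ , dmin) Zd (_ , _ , (cfZd , _ , Zd⊂T , _)) d≡ ¬blunt
  with d ≤? 4
... | yes d≤4 = d≤4
... | no  d≰4  = contradiction blunt ¬blunt
  where
  open Matroid M
  open BinaryMatroid M A rk
  ρZd<ρ⊤ : ρ Zd < ρ ⊤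
  ρZd<ρ⊤ = ≤-trans (flat⊂⇒ρ< (proj₁ cfZd) Zd⊂T) (ρ-mono ⊆⊤)
  blunt : Blunt ρ Zd
  blunt Z′ Z′⋖Zd@((clZ′≡Z′ , _) , _ , Z′⊂Zd , _) = trans (+-comm (ρ Z′) 1) (≤-antisym
    (flat⊂⇒ρ< clZ′≡Z′ Z′⊂Zd)
    (≮⇒≥ λ gap → d≰4 (covered-with-gap⇒d≤4 dmin Z′⋖Zd gap ρZd<ρ⊤ d≡)))
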